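{- Assume the setting below. Let $X\subseteq E$ with $\mathrm{rk}(X)\le\ell-1$, let $\psi:X\to\Gamma$ be robustly consistent, and let $x\in E\setminus\mathrm{cl}(X)$. Then every $\psi':X\cup\{x\}\to\Gamma$ with $\psi\subseteq\psi'$ is robustly consistent.
   Context: Setting: $\mathcal E$ is a family of $2$-connected $3$-regular expander graphs (infinite family with positive infimum of the expansion ratio $\min_{0<|W|\le|V|/2}|\partial(W)|/|W|$), and $c>0$ is a constant such that for every $G\in\mathcal E$ and every $X\subseteq E(G)$ there is $\hat X\supseteq X$ with $|\hat X|\le c|X|$ such that $E(G)\setminus\hat X$ is empty or the edge set of a $2$-connected subgraph of $G$. Fix $G=(V,E)\in\mathcal E$, $n=|V|$, $m=|E|$, $\ell=\lfloor (m-1)/(3c)\rfloor$. For $X\subseteq E$, $\mathrm{cl}(X)$ is the set of edges $x\in E$ such that no cycle of $G$ with edge set contained in $E\setminus X$ contains $x$. A set $I\subseteq E$ is independent if $x\notin\mathrm{cl}(I\setminus\{x\})$ for all $x\in I$, and $\mathrm{rk}(X)$ is the maximum size of an independent subset of $X$. Let $H$ be an orientation of $G$, $\Gamma$ a finite Abelian group, $\sigma:V\to\Gamma$; edges, their orientations, and variables $x_e$ are identified. For $W\subseteq V$, $\partial(W)$ is the set of edges between $W$ and $V\setminus W$, $\partial_\pm(W)$ the edges of $H$ with tail (+) resp. head (−) in $W$ and other end outside $W$, $\sigma(W)=\sum_{w\in W}\sigma(w)$, and $C(W)$ is the constraint $\sum_{e\in\partial_+(W)}x_e-\sum_{e\in\partial_-(W)}x_e=\sigma(W)$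 in $\Gamma$. A partial mapping $\psi$ from $E$ to $\Gamma$ is $k$-consistent if it satisfies $C(W)$ for every $W\subseteq V$ with $|W|\le k$ and $\partial(W)\subseteq\mathrm{dom}(\psi)$; it is robustly consistent if it is $n/3$-consistent.
   Formalization: The constant c of the covering property, which also enters ℓ, is taken to be a positive rational. -}

module Defs where

open import Level using (Level)
open import Data.Nat as ℕ using (ℕ; zero; suc; _≤_; _<_; _*_; _∸_; _/_; _%_)
open import Data.Nat.DivMod using (m%n<n)
open import Data.Nat.Properties using (m*n≢0)
open import Data.Bool using (Bool; true; false; if_then_else_; _∧_; _∨_; not; _xor_)
open import Data.Fin as Fin using (Fin; toℕ; fromℕ<; _≟_)
open import Data.Fin.Subset using (Subset; _∈_; _∉_; _⊆_; ∁; _-_; ∣_∣; Empty)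
open import Data.Vec using (lookup; tabulate)
open import Data.Product using (Σ; ∃; ∃-syntax; _×_; _,_; proj₁; proj₂)
open import Data.Sum using (_⊎_)
open import Data.Unit using (⊤)
open import Relation.Nullary using (¬_)
open import Relation.Nullary.Decidable using (⌊_⌋)
open import Relation.Binary.PropositionalEquality using (_≡_; _≢_)
open import Function.Definitions using (Injective)
open import Algebra.Bundles using (AbelianGroup)

record Graph : Set where
  field
    n    : ℕ
    m    : ℕ
    end₁ : Fin m → Fin n
    end₂ : Fin m → Fin n
    noLoop  : ∀ e → end₁ e ≢ end₂ e
    noMulti : ∀ e e' →
      ((end₁ e ≡ end₁ e' × end₂ e ≡ end₂ e') ⊎ (end₁ e ≡ end₂ e' × end₂ e ≡ end₁ e')) →
      e ≡ e'

module _ (G : Graph) where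
  open Graph G

  Joins : Fin m → Fin n → Fin n → Set
  Joins e u w = (end₁ e ≡ u × end₂ e ≡ w) ⊎ (end₁ e ≡ w × end₂ e ≡ u)

  incident : Fin n → Subset m
  incident v = tabulate (λ e → ⌊ end₁ e ≟ v ⌋ ∨ ⌊ end₂ e ≟ v ⌋)

  Cubic : Set
  Cubic = ∀ v → ∣ incident v ∣ ≡ 3

  boundary : Subset n → Subset m
  boundary W = tabulate (λ e → lookup W (end₁ e) xor lookup W (end₂ e))

  -- walks using only edges of F, all of whose vertices after the first
  -- satisfy Allowed
  data Walk (F : Subset m) (Allowed : Fin n → Set) : Fin n → Fin n → Set where
    []  : ∀ {u} → Walk F Allowed u u
    _∷_ : ∀ {u w z} → (∃[ e ] (e ∈ F × Joins e u w × Allowed w)) →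
          Walk F Allowed w z → Walk F Allowed u z

  InV : Subset m → Fin n → Set
  InV F v = ∃[ e ] (e ∈ F × (end₁ e ≡ v ⊎ end₂ e ≡ v))

  TwoConnectedOn : Subset m → (Fin n → Set) → Set
  TwoConnectedOn F Vs =
    (∃[ a ] ∃[ b ] ∃[ c ] (Vs a × Vs b × Vs c × a ≢ b × a ≢ c × b ≢ c)) ×
    (∀ u w → Vs u → Vs w → Walk F (λ _ → ⊤) u w) ×
    (∀ v u w → Vs u → Vs w → u ≢ v → w ≢ v → Walk F (λ z → z ≢ v) u w)

  TwoConnected : Set
  TwoConnected = TwoConnectedOn (tabulate (λ _ → true)) (λ _ → ⊤)

  TwoConnectedEdgeSet : Subset m → Set
  TwoConnectedEdgeSet F = TwoConnectedOn F (InV F)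

  next : ∀ {k} → Fin (suc k) → Fin (suc k)
  next {k} i = fromℕ< (m%n<n (suc (toℕ i)) (suc k))

  record Cycle : Set where
    field
      len   : ℕ
      verts : Fin (suc len) → Fin n
      edges : Fin (suc len) → Fin m
      verts-inj : Injective _≡_ _≡_ verts
      edges-inj : Injective _≡_ _≡_ edges
      joins : ∀ i → Joins (edges i) (verts i) (verts (next i))

  Cl : Subset m → Fin m → Set
  Cl X x = ¬ (Σ Cycle λ C →
              (∀ i → Cycle.edges C i ∉ X) × ∃[ i ] (Cycle.edges C i ≡ x))

  Independent : Subset m → Set
  Independent I = ∀ x → x ∈ I → ¬ Cl (I - x) x

  RankAtMost : Subset m → ℕ → Set
  RankAtMost X r = ∀ I → I ⊆ X → Independent I → ∣ I ∣ ≤ r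

  -- rk(X) ≤ ℓ - 1  (as integers), i.e. rk(X) < ℓ
  RankBelow : Subset m → ℕ → Set
  RankBelow X ℓ = ∀ I → I ⊆ X → Independent I → suc ∣ I ∣ ≤ ℓ

  -- the covering property with constant c = p / q:
  -- every X has X̂ ⊇ X, |X̂| ≤ c|X|, E∖X̂ empty or 2-connected edge set
  CoverProperty : ℕ → ℕ → Set
  CoverProperty p q = ∀ (X : Subset m) → ∃[ X̂ ] (X ⊆ X̂ × q * ∣ X̂ ∣ ≤ p * ∣ X ∣ ×
                        (Empty (∁ X̂) ⊎ TwoConnectedEdgeSet (∁ X̂)))

  -- ℓ = ⌊ (m - 1) / (3c) ⌋ with c = p / q, i.e. ⌊ (m-1) q / (3p) ⌋
  ellOf : (p q : ℕ) → .{{_ : ℕ.NonZero p}} → ℕ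
  ellOf p q = ((m ∸ 1) * q) / (3 * p)
    where instance nz : ℕ.NonZero (3 * p)
                   nz = m*n≢0 3 p

  -- an orientation H of G: o e = true means end₁ e is the tail
  Orientation : Set
  Orientation = Fin m → Bool

  tail head : Orientation → Fin m → Fin n
  tail o e = if o e then end₁ e else end₂ e
  head o e = if o e then end₂ e else end₁ e

ExpanderFamily : (ℕ → Graph) → Set
ExpanderFamily 𝓔 =
  (∀ N → ∃[ k ] (N ≤ Graph.n (𝓔 k))) ×
  (∃[ a ] ∃[ b ] (0 < a × 0 < b ×
    (∀ k (W : Subset (Graph.n (𝓔 k))) → 0 < ∣ W ∣ → 2 * ∣ W ∣ ≤ Graph.n (𝓔 k) →
      a * ∣ W ∣ ≤ b * ∣ boundary (𝓔 k) W ∣)))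

IsFinite : ∀ {c ℓ} → AbelianGroup c ℓ → Set _
IsFinite Γ = ∃[ N ] Σ (Fin N → Carrier) λ f → ∀ g → ∃[ i ] (f i ≈ g)
  where open AbelianGroup Γ

module _ {c ℓ} (Γ : AbelianGroup c ℓ) where
  open AbelianGroup Γ

  sumFin : ∀ {k} → (Fin k → Carrier) → Carrier
  sumFin {zero}  f = ε
  sumFin {suc k} f = f Fin.zero ∙ sumFin (λ i → f (Fin.suc i))

module _ (G : Graph) {c ℓ} (Γ : AbelianGroup c ℓ) (o : Orientation G) where
  open Graph G
  open AbelianGroup Γ

  outOf inTo : Subset n → Fin m → Bool
  outOf W e = lookup W (tail G o e) ∧ not (lookup W (head G o e))
  inTo  W e = lookup W (head G o e) ∧ not (lookup W (tail G o e))

  σOf : (Fin n → Carrier) → Subset n → Carrier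
  σOf σ W = sumFin Γ (λ v → if lookup W v then σ v else ε)

  Constraint : (Fin n → Carrier) → Subset n → (Fin m → Carrier) → Set ℓ
  Constraint σ W ψ =
    sumFin Γ (λ e → if outOf W e then ψ e else ε) ∙
      (sumFin Γ (λ e → if inTo W e then ψ e else ε)) ⁻¹ ≈ σOf σ W

  -- a partial map with domain D is represented by a total map ψ together
  -- with D; only values on D matter.
  -- robustly consistent = n/3-consistent: C(W) for all W with |W| ≤ n/3
  -- and ∂(W) ⊆ D
  RobustlyConsistent : (Fin n → Carrier) → Subset m → (Fin m → Carrier) → Set ℓ
  RobustlyConsistent σ D ψ =
    ∀ (W : Subset n) → 3 * ∣ W ∣ ≤ n → boundary G W ⊆ D → Constraint σ W ψ

module Submission where

-- The constraint C(W) only reads the values of ψ on the cut ∂(W).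
-- Let x ∉ cl(X), so x lies on a cycle C whose edges avoid X.  A cycle
-- crosses every cut an even number of times; in particular it cannot cross
-- ∂(W) in exactly one edge.  Hence, if ∂(W) ⊆ X ∪ {x}, the edge x is not in
-- ∂(W) (otherwise it would be the only edge of C in ∂(W)), so ∂(W) ⊆ X.
-- There ψ' agrees with ψ, and C(W) for ψ' follows from C(W) for ψ.

open import Defs
open import Level using (Level)
open import Data.Nat using (ℕ; _<_; NonZero)
open import Data.Fin using (Fin)
open import Data.Fin.Subset using (Subset; _∈_; _∪_; ⁅_⁆)
open import Data.Product using (_×_)
open import Relation.Nullary using (¬_)
open import Algebra.Bundles using (AbelianGroup)

open import Data.Nat using (zero; suc; _+_; _∸_; _%_; s≤s)
open import Data.Nat.Properties
  using (+-identityʳ; +-suc; +-monoʳ-<; ∸-monoˡ-<; m+n∸n≡m; m+1+n≢m; <⇒≢; <-trans;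
         ≰⇒>; _≤?_; m<n⇒m<1+n; n<1+n)
open import Data.Nat.DivMod
  using (_mod_; %-distribˡ-+; m%n%n≡m%n; [m+n]%n≡m%n; m<n⇒m%n≡m; m≤n⇒[n∸m]%m≡n%m)
import Data.Fin as Fin
open import Data.Fin using (toℕ)
open import Data.Fin.Properties using (fromℕ<-cong; toℕ-fromℕ<; toℕ-injective; toℕ<n)
open import Data.Fin.Subset using (_∉_; _⊆_)
open import Data.Fin.Subset.Properties using (x∈p∪q⁻; x∈⁅y⁆⇒x≡y)
open import Data.Vec using (lookup)
open import Data.Vec.Properties using (lookup⇒[]=; []=⇒lookup; lookup∘tabulate)
open import Data.Bool using (Bool; true; false; _xor_; _∧_; not; if_then_else_)
open import Data.Bool.Properties using (xor-comm) renaming (_≟_ to _≟ᵇ_)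
open import Data.Product using (_,_)
open import Data.Sum using (inj₁; inj₂)
open import Data.Empty using (⊥-elim)
open import Relation.Nullary using (yes; no)
open import Relation.Binary.PropositionalEquality
  using (_≡_; _≢_; refl; sym; trans; cong; subst; module ≡-Reasoning)

≢⇒xor-true : ∀ {b c : Bool} → b ≢ c → b xor c ≡ true
≢⇒xor-true {false} {false} b≢c = ⊥-elim (b≢c refl)
≢⇒xor-true {false} {true}  _   = refl
≢⇒xor-true {true}  {false} _   = refl
≢⇒xor-true {true}  {true}  b≢c = ⊥-elim (b≢c refl)

xor-true⇒≢ : ∀ {b c : Bool} → b xor c ≡ true → b ≢ c
xor-true⇒≢ {false} {true}  _ ()
xor-true⇒≢ {true}  {false} _ ()

∧-not-true⇒≢ : ∀ {b c : Bool} → b ∧ not c ≡ true → b ≢ c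
∧-not-true⇒≢ {true} {false} _ ()

constant-run : ∀ {A : Set} (h : ℕ → A) (a d : ℕ) →
  (∀ j → j < d → h (a + j) ≡ h (suc (a + j))) → h a ≡ h (a + d)
constant-run h a zero    _    = cong h (sym (+-identityʳ a))
constant-run h a (suc d) step = begin
  h a             ≡⟨ constant-run h a d (λ j j<d → step j (m<n⇒m<1+n j<d)) ⟩
  h (a + d)       ≡⟨ step d (n<1+n d) ⟩
  h (suc (a + d)) ≡⟨ cong h (sym (+-suc a d)) ⟩
  h (a + suc d)   ∎
  where open ≡-Reasoning

-- Positions on a cycle of length L = suc k are Fin L, and `next` is the
-- successor modulo L.  (In Defs, `next` lives in a module parameterised by
-- a graph, on which it does not depend.)
module Cyclic (G : Graph) (k : ℕ) where
  open ≡-Reasoning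

  L : ℕ
  L = suc k

  mod-toℕ : ∀ (i : Fin L) → toℕ i mod L ≡ i
  mod-toℕ i = toℕ-injective (trans (toℕ-fromℕ< _) (m<n⇒m%n≡m (toℕ<n i)))

  next-mod : ∀ t → next G (t mod L) ≡ suc t mod L
  next-mod t = fromℕ<-cong _ _ suc-residue _ _
    where
    suc-residue : suc (toℕ (t mod L)) % L ≡ suc t % L
    suc-residue = begin
      suc (toℕ (t mod L)) % L ≡⟨ cong (λ z → suc z % L) (toℕ-fromℕ< _) ⟩
      (1 + t % L) % L         ≡⟨ %-distribˡ-+ 1 (t % L) L ⟩
      (1 % L + t % L % L) % L ≡⟨ cong (λ z → (1 % L + z) % L) (m%n%n≡m%n t L) ⟩
      (1 % L + t % L) % L     ≡⟨ %-distribˡ-+ 1 t L ⟨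
      suc t % L               ∎

  mod-periodic : ∀ t → (t + L) mod L ≡ t mod L
  mod-periodic t = fromℕ<-cong _ _ ([m+n]%n≡m%n t L) _ _

  shift-moves : ∀ r s → r < L → suc s < L → (r + suc s) % L ≢ r
  shift-moves r s r<L s<L with L ≤? r + suc s
  ... | no  r+s<L = λ eq → m+1+n≢m r (trans (sym (m<n⇒m%n≡m (≰⇒> r+s<L))) eq)
  ... | yes L≤r+s = λ eq → <⇒≢ wrapped<r (trans (sym residue) eq)
    where
    wrapped : ℕ
    wrapped = r + suc s ∸ L
    wrapped<r : wrapped < r
    wrapped<r = subst (wrapped <_) (m+n∸n≡m r L) (∸-monoˡ-< (+-monoʳ-< r s<L) L≤r+s)
    residue : (r + suc s) % L ≡ wrapped
    residue = trans (sym (m≤n⇒[n∸m]%m≡n%m L≤r+s)) (m<n⇒m%n≡m (<-trans wrapped<r r<L))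

  -- Follow the cycle from next i all the way round to i.
  cyclic-stable : ∀ {A : Set} (f : Fin L → A) (i : Fin L) →
    (∀ j → j ≢ i → f j ≡ f (next G j)) → f i ≡ f (next G i)
  cyclic-stable {A} f i stable = begin
    f i                  ≡⟨ cong f (mod-toℕ i) ⟨
    h r                  ≡⟨ cong f (mod-periodic r) ⟨
    h (r + L)            ≡⟨ cong h (+-suc r k) ⟩
    h (suc r + k)        ≡⟨ constant-run h (suc r) k steps ⟨
    h (suc r)            ≡⟨ cong f (next-mod r) ⟨
    f (next G (r mod L)) ≡⟨ cong (λ j → f (next G j)) (mod-toℕ i) ⟩
    f (next G i)         ∎
    where
    r : ℕ
    r = toℕ i
    h : ℕ → A
    h t = f (t mod L)
    avoids-i : ∀ j → j < k → (suc r + j) mod L ≢ i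
    avoids-i j j<k eq = shift-moves r j (toℕ<n i) (s≤s j<k)
      (trans (cong (_% L) (+-suc r j)) (trans (sym (toℕ-fromℕ< _)) (cong toℕ eq)))
    steps : ∀ j → j < k → h (suc r + j) ≡ h (suc (suc r + j))
    steps j j<k = trans (stable _ (avoids-i j j<k)) (cong f (next-mod (suc r + j)))

module Cuts (G : Graph) where
  open Graph G

  boundary-lookup : ∀ W {e u w} → Joins G e u w →
    lookup (boundary G W) e ≡ lookup W u xor lookup W w
  boundary-lookup W {e} (inj₁ (refl , refl)) = lookup∘tabulate _ e
  boundary-lookup W {e} (inj₂ (refl , refl)) =
    trans (lookup∘tabulate _ e) (xor-comm (lookup W (end₁ e)) (lookup W (end₂ e)))

  separated⇒∈boundary : ∀ W {e u w} → Joins G e u w →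
    lookup W u ≢ lookup W w → e ∈ boundary G W
  separated⇒∈boundary W {e} uw u≁w =
    lookup⇒[]= e _ (trans (boundary-lookup W uw) (≢⇒xor-true u≁w))

  ∈boundary⇒separated : ∀ W {e u w} → Joins G e u w →
    e ∈ boundary G W → lookup W u ≢ lookup W w
  ∈boundary⇒separated W {e} uw e∈∂ =
    xor-true⇒≢ (trans (sym (boundary-lookup W uw)) ([]=⇒lookup e∈∂))

  -- A cycle never meets a cut in exactly one edge: the side of W on which
  -- the cycle's vertices lie can change only at cut edges.
  cycle-meets-cut-twice : (C : Cycle G) (W : Subset n) (i : Fin (suc (Cycle.len C))) →
    (∀ j → j ≢ i → Cycle.edges C j ∉ boundary G W) → Cycle.edges C i ∉ boundary G W
  cycle-meets-cut-twice C W i others eᵢ∈∂ =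
    ∈boundary⇒separated W (joins i) eᵢ∈∂ (Cyclic.cyclic-stable G len side i same-side)
    where
    open Cycle C
    side : Fin (suc len) → Bool
    side j = lookup W (verts j)
    same-side : ∀ j → j ≢ i → side j ≡ side (next G j)
    same-side j j≢i with side j ≟ᵇ side (next G j)
    ... | yes eq = eq
    ... | no  ne = ⊥-elim (others j j≢i (separated⇒∈boundary W (joins j) ne))

  -- If x ∉ cl(X) and the cut of W lies in X ∪ {x}, then it lies in X:
  -- x is on a cycle avoiding X, which would meet the cut only in x.
  cut-avoids-coclosure : ∀ {X x} W → ¬ Cl G X x →
    boundary G W ⊆ X ∪ ⁅ x ⁆ → boundary G W ⊆ X
  cut-avoids-coclosure {X} {x} W x∉cl ∂W⊆ e∈∂ with x∈p∪q⁻ X ⁅ x ⁆ (∂W⊆ e∈∂)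
  ... | inj₁ e∈X = e∈X
  ... | inj₂ e∈x = ⊥-elim (x∉cl λ { (C , avoidsX , i , eᵢ≡x) →
          cycle-meets-cut-twice C W i (only-x C avoidsX i eᵢ≡x)
            (subst (_∈ boundary G W) (trans (x∈⁅y⁆⇒x≡y x e∈x) (sym eᵢ≡x)) e∈∂) })
    where
    only-x : (C : Cycle G) → (∀ j → Cycle.edges C j ∉ X) →
      ∀ i → Cycle.edges C i ≡ x → ∀ j → j ≢ i → Cycle.edges C j ∉ boundary G W
    only-x C avoidsX i eᵢ≡x j j≢i eⱼ∈∂ with x∈p∪q⁻ X ⁅ x ⁆ (∂W⊆ eⱼ∈∂)
    ... | inj₁ eⱼ∈X = avoidsX j eⱼ∈X
    ... | inj₂ eⱼ∈x = j≢i (Cycle.edges-inj C (trans (x∈⁅y⁆⇒x≡y x eⱼ∈x) (sym eᵢ≡x)))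

module Sums {c ℓ} (Γ : AbelianGroup c ℓ) where
  open AbelianGroup Γ using (Carrier; _≈_; ε; ∙-cong) renaming (refl to ≈-refl)

  sumFin-cong : ∀ {k} {f g : Fin k → Carrier} → (∀ i → f i ≈ g i) → sumFin Γ f ≈ sumFin Γ g
  sumFin-cong {zero}  _   = ≈-refl
  sumFin-cong {suc k} f≈g = ∙-cong (f≈g Fin.zero) (sumFin-cong (λ i → f≈g (Fin.suc i)))

  selected-sum-cong : ∀ {k} (s : Fin k → Bool) {f g : Fin k → Carrier} →
    (∀ i → s i ≡ true → f i ≈ g i) →
    sumFin Γ (λ i → if s i then f i else ε) ≈ sumFin Γ (λ i → if s i then g i else ε)
  selected-sum-cong s {f} {g} f≈g = sumFin-cong pointwise
    where
    pointwise : ∀ i → (if s i then f i else ε) ≈ (if s i then g i else ε)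
    pointwise i with s i in selected
    ... | true  = f≈g i selected
    ... | false = ≈-refl

module Locality (G : Graph) {c ℓ} (Γ : AbelianGroup c ℓ) (o : Orientation G) where
  open Graph G using (n; m)
  open AbelianGroup Γ using (Carrier; _≈_; ∙-cong; ⁻¹-cong) renaming (trans to ≈-trans)
  open Cuts G
  open Sums Γ

  tail-head-joins : ∀ e → Joins G e (tail G o e) (head G o e)
  tail-head-joins e with o e
  ... | true  = inj₁ (refl , refl)
  ... | false = inj₂ (refl , refl)

  outOf⇒∈boundary : ∀ W e → outOf G Γ o W e ≡ true → e ∈ boundary G W
  outOf⇒∈boundary W e out =
    separated⇒∈boundary W (tail-head-joins e) (∧-not-true⇒≢ out)

  inTo⇒∈boundary : ∀ W e → inTo G Γ o W e ≡ true → e ∈ boundary G W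
  inTo⇒∈boundary W e in′ with tail-head-joins e
  ... | inj₁ ends = separated⇒∈boundary W (inj₂ ends) (∧-not-true⇒≢ in′)
  ... | inj₂ ends = separated⇒∈boundary W (inj₁ ends) (∧-not-true⇒≢ in′)

  constraint-local : ∀ (σ : Fin n → Carrier) W {ψ ψ' : Fin m → Carrier} →
    (∀ e → e ∈ boundary G W → ψ' e ≈ ψ e) →
    Constraint G Γ o σ W ψ → Constraint G Γ o σ W ψ'
  constraint-local σ W agree C-ψ = ≈-trans
    (∙-cong (selected-sum-cong (outOf G Γ o W) (λ e s → agree e (outOf⇒∈boundary W e s)))
            (⁻¹-cong (selected-sum-cong (inTo G Γ o W) (λ e s → agree e (inTo⇒∈boundary W e s)))))
    C-ψ

mainTheorem12 : ∀ {a b : Level}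
    (𝓔 : ℕ → Graph) → ExpanderFamily 𝓔 →
    (∀ k → TwoConnected (𝓔 k) × Cubic (𝓔 k)) →
    (p q : ℕ) → .{{_ : NonZero p}} → 0 < q →
    (∀ k → CoverProperty (𝓔 k) p q) →
    (k : ℕ) →
    (o : Orientation (𝓔 k)) →
    (Γ : AbelianGroup a b) → IsFinite Γ →
    (σ : Fin (Graph.n (𝓔 k)) → AbelianGroup.Carrier Γ) →
    (X : Subset (Graph.m (𝓔 k))) →
    RankBelow (𝓔 k) X (ellOf (𝓔 k) p q) →
    (ψ : Fin (Graph.m (𝓔 k)) → AbelianGroup.Carrier Γ) →
    RobustlyConsistent (𝓔 k) Γ o σ X ψ →
    (x : Fin (Graph.m (𝓔 k))) → ¬ Cl (𝓔 k) X x →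
    (ψ' : Fin (Graph.m (𝓔 k)) → AbelianGroup.Carrier Γ) →
    (∀ e → e ∈ X → AbelianGroup._≈_ Γ (ψ' e) (ψ e)) →
    RobustlyConsistent (𝓔 k) Γ o σ (X ∪ ⁅ x ⁆) ψ'
mainTheorem12 𝓔 _ _ _ _ _ _ k o Γ _ σ X _ ψ ψ-robust x x∉cl ψ' ψ'≈ψ W small ∂W⊆X∪x =
  Locality.constraint-local (𝓔 k) Γ o σ W (λ e e∈∂ → ψ'≈ψ e (∂W⊆X e∈∂))
    (ψ-robust W small ∂W⊆X)
  where
  -- the cut of W misses x, since x lies on a cycle avoiding X
  ∂W⊆X : boundary (𝓔 k) W ⊆ X
  ∂W⊆X = Cuts.cut-avoids-coclosure (𝓔 k) W x∉cl ∂W⊆X∪x
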